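{- Let $n\ge 1$ and $\nu\ge 1$ be integers and $\delta\in\{0,1,2\}$. If $[a_1,a_2,\ldots,a_{2\nu+\delta}]$ is a vertex of the orthogonal graph $\mathcal{O}^{(2\nu+\delta)}_{2^n}$, then $a_i\in\mathbb{Z}_{2^n}^\times$ for some $i\in\{1,2,\ldots,2\nu\}$.
   Context: For integers $k\ge1$, $\nu\ge 1$ and $\delta\in\{0,1,2\}$, let $V^{2\nu+\delta}$ be the set of tuples $\vec a=(a_1,\ldots,a_{2\nu+\delta})\in\mathbb{Z}_{2^k}^{2\nu+\delta}$ such that some $a_i$ is a unit of $\mathbb{Z}_{2^k}$. Write $\vec a\sim\vec b$ if $\vec a=\lambda\vec b$ for some $\lambda\in\mathbb{Z}_{2^k}^\times$, and let $[\vec a]=[a_1,\ldots,a_{2\nu+\delta}]$ denote the class of $\vec a$. Let $G_{2\nu+\delta,\Delta}$ be the $(2\nu+\delta)\times(2\nu+\delta)$ block diagonal matrix over $\mathbb{Z}_{2^k}$ whose first block is $\begin{pmatrix}0&I_\nu\\0&0\end{pmatrix}$ and whose second block is $\Delta$, where $\Delta$ is absent if $\delta=0$, $\Delta=(1)$ if $\delta=1$, and $\Delta=\begin{pmatrix}z&1\\0&z\end{pmatrix}$ if $\delta=2$, with $z$ a fixed unit of $\mathbb{Z}_{2^k}$ (equivalently $z\notin\{x^2+x:x\in\mathbb{Z}_{2^k}\}$). The orthogonal graph $\mathcal{O}^{(2\nu+\delta)}_{2^k}$ has vertex set $\{[\vec a]: \vec a\in V^{2\nu+\delta},\ \vec a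 G_{2\nu+\delta,\Delta}\vec a^t=0\}$, and $[\vec a]$ is adjacent to $[\vec b]$ iff $\vec a(G_{2\nu+\delta,\Delta}+G_{2\nu+\delta,\Delta}^t)\vec b^t\in\mathbb{Z}_{2^k}^\times$. -}

module Defs where

open import Data.Nat using (ℕ; zero; suc; _+_; _*_; _^_; _%_; NonZero)
open import Data.Nat.Properties using (m^n≢0)
open import Data.Fin using (Fin; toℕ; _↑ˡ_; _↑ʳ_; zero; suc)
open import Data.Product using (Σ; ∃; _×_; _,_)
open import Relation.Binary.PropositionalEquality using (_≡_)

-- The ring ℤ_{2^n}: elements are Fin (2 ^ n); arithmetic is ℕ-arithmetic
-- on representatives followed by reduction modulo 2 ^ n.
Zmod : ℕ → Set
Zmod n = Fin (2 ^ n)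

pow2-nonZero : (n : ℕ) → NonZero (2 ^ n)
pow2-nonZero n = m^n≢0 2 n

_mod2^_ : ℕ → ℕ → ℕ
x mod2^ n = _%_ x (2 ^ n) {{pow2-nonZero n}}

IsUnit : (n : ℕ) → Zmod n → Set
IsUnit n x = ∃ λ (y : Zmod n) → (toℕ x * toℕ y) mod2^ n ≡ 1 mod2^ n

Vect : (n ν : ℕ) (δ : Fin 3) → Set
Vect n ν δ = Fin ((ν + ν) + toℕ δ) → Zmod n

InV : (n ν : ℕ) (δ : Fin 3) → Vect n ν δ → Set
InV n ν δ a = ∃ λ i → IsUnit n (a i)

sumFin : (ν : ℕ) → (Fin ν → ℕ) → ℕ
sumFin zero f = 0
sumFin (suc ν) f = f zero + sumFin ν (λ i → f (suc i))

qΔ : (δ : Fin 3) → ℕ → (Fin (toℕ δ) → ℕ) → ℕ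
qΔ zero z w = 0
qΔ (suc zero) z w = w zero * w zero
qΔ (suc (suc zero)) z w =
  z * w zero * w zero + w zero * w (suc zero) + z * w (suc zero) * w (suc zero)

-- a G_{2ν+δ,Δ} a^t, computed in ℕ on representatives (reduce mod 2^n after)
quadForm : (n ν : ℕ) (δ : Fin 3) (z : Zmod n) → Vect n ν δ → ℕ
quadForm n ν δ z a =
  sumFin ν (λ i → toℕ (a ((i ↑ˡ ν) ↑ˡ toℕ δ))
                 * toℕ (a ((ν ↑ʳ i) ↑ˡ toℕ δ)))
  + qΔ δ (toℕ z) (λ j → toℕ (a ((ν + ν) ↑ʳ j)))

IsVertexRep : (n ν : ℕ) (δ : Fin 3) (z : Zmod n) → Vect n ν δ → Set
IsVertexRep n ν δ z a = InV n ν δ a × (quadForm n ν δ z a mod2^ n ≡ 0)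

module Submission where

-- Reduction modulo 2 is a ring map ℤ_{2^n} → 𝔽₂ (n ≥ 1),
-- and an element of ℤ_{2^n} is a unit exactly when its representative is
-- odd.  Suppose every one of the first 2ν coordinates of a vertex a is even.
-- Then the hyperbolic part  Σ a_i a_{ν+i}  of the quadratic form is even,
-- while the unit coordinate of a must lie in the Δ-block; since z is odd,
-- the Δ-form  x²  resp.  z x² + x y + z y²  is anisotropic over 𝔽₂, so it is
-- odd at a.  Hence  a G aᵗ  is odd, contradicting  a G aᵗ ≡ 0 (mod 2^n).

open import Defs
open import Data.Nat using (ℕ; _+_; _≥_; zero; suc; _*_; _^_; _%_; NonZero; s≤s)
open import Data.Nat.Properties using (*-comm; _≟_)
open import Data.Nat.DivMod using (m%n<n; m%n%n≡m%n; %-distribˡ-+; %-distribˡ-*; [m+kn]%n≡m%n; m∣n⇒o%n%m≡o%m)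
open import Data.Nat.Divisibility using (_∣_; m∣m*n; ∣1⇒≡1; ∣m⇒∣m*n; n∣m⇒m%n≡0)
open import Data.Nat.Coprimality using (Coprime; coprime-Bézout; coprime-factors)
open import Data.Nat.GCD using (module Bézout)
open import Data.Nat.Primality using (Prime; prime[2]; prime⇒irreducible)
open import Data.Nat.Tactic.RingSolver using (solve-∀)
open import Data.Fin using (Fin; toℕ; _↑ˡ_; _↑ʳ_; splitAt; fromℕ<; zero; suc)
open import Data.Fin.Properties using (any?; splitAt⁻¹-↑ˡ; splitAt⁻¹-↑ʳ; toℕ-fromℕ<)
open import Data.Product using (∃; _,_; proj₁; proj₂)
open import Data.Sum using (_⊎_; inj₁; inj₂)
open import Data.Empty using (⊥-elim)
open import Relation.Nullary using (¬_; yes; no; contradiction)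
open import Relation.Binary.PropositionalEquality
  using (_≡_; refl; sym; trans; cong; cong₂; module ≡-Reasoning)

-- Congruence modulo 2 on natural numbers.  It is a record (rather than a
-- bare equation between remainders) so that both sides can be inferred.
infix 4 _≡₂_
record _≡₂_ (x y : ℕ) : Set where
  constructor mod2
  field mod2-eq : x % 2 ≡ y % 2
open _≡₂_

parity : ∀ x → x ≡₂ 0 ⊎ x ≡₂ 1
parity x with x % 2 in eq | m%n<n x 2
... | 0           | _            = inj₁ (mod2 eq)
... | 1           | _            = inj₂ (mod2 eq)
... | suc (suc _) | s≤s (s≤s ())

even-odd-absurd : ∀ {x} → x ≡₂ 0 → ¬ x ≡₂ 1
even-odd-absurd (mod2 even) (mod2 odd) with trans (sym even) odd
... | ()

+-cong₂ : ∀ {x x′ y y′} → x ≡₂ x′ → y ≡₂ y′ → x + y ≡₂ x′ + y′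
+-cong₂ {x} {x′} {y} {y′} (mod2 p) (mod2 q) = mod2 (begin
  (x + y) % 2                 ≡⟨ %-distribˡ-+ x y 2 ⟩
  (x % 2 + y % 2) % 2         ≡⟨ cong₂ (λ u v → (u + v) % 2) p q ⟩
  (x′ % 2 + y′ % 2) % 2       ≡⟨ %-distribˡ-+ x′ y′ 2 ⟨
  (x′ + y′) % 2               ∎)
  where open ≡-Reasoning

*-cong₂ : ∀ {x x′ y y′} → x ≡₂ x′ → y ≡₂ y′ → x * y ≡₂ x′ * y′
*-cong₂ {x} {x′} {y} {y′} (mod2 p) (mod2 q) = mod2 (begin
  (x * y) % 2                 ≡⟨ %-distribˡ-* x y 2 ⟩
  (x % 2 * (y % 2)) % 2       ≡⟨ cong₂ (λ u v → (u * v) % 2) p q ⟩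
  (x′ % 2 * (y′ % 2)) % 2     ≡⟨ %-distribˡ-* x′ y′ 2 ⟨
  (x′ * y′) % 2               ∎)
  where open ≡-Reasoning

≡₂-trans : ∀ {x y w} → x ≡₂ y → y ≡₂ w → x ≡₂ w
≡₂-trans (mod2 p) (mod2 q) = mod2 (trans p q)

mod2^-parity : ∀ n → n ≥ 1 → ∀ x → x mod2^ n ≡₂ x
mod2^-parity (suc m) _ x =
  mod2 (m∣n⇒o%n%m≡o%m 2 (2 ^ suc m) x {{_}} {{pow2-nonZero (suc m)}} (m∣m*n (2 ^ m)))

¬∣⇒coprime : ∀ {p x} → Prime p → ¬ p ∣ x → Coprime x p
¬∣⇒coprime pp p∤x (d∣x , d∣p) with prime⇒irreducible pp d∣p
... | inj₁ d≡1  = d≡1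
... | inj₂ refl = contradiction d∣x p∤x

coprime-^ : ∀ {x p} → Coprime x p → ∀ k → Coprime x (p ^ k)
coprime-^ c zero    (_ , d∣1)      = ∣1⇒≡1 d∣1
coprime-^ c (suc k) (d∣x , d∣p^1+k) =
  coprime-^ c k (d∣x , coprime-factors c (∣m⇒∣m*n _ d∣x , d∣p^1+k))

coprime⇒invertible : ∀ x N .{{_ : NonZero N}} → Coprime x N → ∃ λ t → (x * t) % N ≡ 1 % N
coprime⇒invertible x N c with coprime-Bézout c
... | Bézout.+- s r eq = s , (begin
  (x * s) % N     ≡⟨ cong (_% N) (trans (*-comm x s) (sym eq)) ⟩
  (1 + r * N) % N ≡⟨ [m+kn]%n≡m%n 1 r N ⟩
  1 % N           ∎)
  where open ≡-Reasoning
coprime⇒invertible x N@(suc M) c | Bézout.-+ s r eq = s * M , (begin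
  (x * (s * M)) % N                 ≡⟨ [m+kn]%n≡m%n (x * (s * M)) r N ⟨
  (x * (s * M) + r * N) % N         ≡⟨ cong (λ u → (x * (s * M) + u) % N) (sym eq) ⟩
  (x * (s * M) + (1 + s * x)) % N   ≡⟨ cong (_% N) (expand x s M) ⟩
  (1 + (x * s) * N) % N             ≡⟨ [m+kn]%n≡m%n 1 (x * s) N ⟩
  1 % N                             ∎)
  where
  open ≡-Reasoning
  expand : ∀ x s M → x * (s * M) + (1 + s * x) ≡ 1 + (x * s) * suc M
  expand = solve-∀

*-%-absorbʳ : ∀ m n d .{{_ : NonZero d}} → (m * (n % d)) % d ≡ (m * n) % d
*-%-absorbʳ m n d = begin
  (m * (n % d)) % d           ≡⟨ %-distribˡ-* m (n % d) d ⟩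
  ((m % d) * (n % d % d)) % d ≡⟨ cong (λ u → ((m % d) * u) % d) (m%n%n≡m%n n d) ⟩
  ((m % d) * (n % d)) % d     ≡⟨ %-distribˡ-* m n d ⟨
  (m * n) % d                 ∎
  where open ≡-Reasoning

odd⇒unit : ∀ n (x : Zmod n) → toℕ x ≡₂ 1 → IsUnit n x
odd⇒unit n x (mod2 x-odd) = fromℕ< (m%n<n t N) , (begin
  (toℕ x * toℕ (fromℕ< (m%n<n t N))) % N ≡⟨ cong (λ u → (toℕ x * u) % N) (toℕ-fromℕ< (m%n<n t N)) ⟩
  (toℕ x * (t % N)) % N                  ≡⟨ *-%-absorbʳ (toℕ x) t N ⟩
  (toℕ x * t) % N                        ≡⟨ xt≡1 ⟩
  1 % N                                  ∎)
  where
  open ≡-Reasoning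
  N : ℕ
  N = 2 ^ n
  instance
    N-nonZero : NonZero N
    N-nonZero = pow2-nonZero n

  2∤x : ¬ 2 ∣ toℕ x
  2∤x 2∣x with trans (sym x-odd) (n∣m⇒m%n≡0 (toℕ x) 2 2∣x)
  ... | ()

  inverse : ∃ λ t → (toℕ x * t) % N ≡ 1 % N
  inverse = coprime⇒invertible (toℕ x) N (coprime-^ (¬∣⇒coprime prime[2] 2∤x) n)

  t : ℕ
  t = proj₁ inverse
  xt≡1 : (toℕ x * t) % N ≡ 1 % N
  xt≡1 = proj₂ inverse

-- Conversely, for n ≥ 1 units of ℤ_{2^n} are odd: an even x has x·y even.
unit⇒odd : ∀ n → n ≥ 1 → (x : Zmod n) → IsUnit n x → toℕ x ≡₂ 1
unit⇒odd n n≥1 x (y , xy≡1) with parity (toℕ x)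
... | inj₂ odd  = odd
... | inj₁ even = contradiction xy-odd (even-odd-absurd (*-cong₂ {y′ = toℕ y} even (mod2 refl)))
  where
  xy-odd : toℕ x * toℕ y ≡₂ 1
  xy-odd = mod2 (begin
    (toℕ x * toℕ y) % 2           ≡⟨ mod2-eq (mod2^-parity n n≥1 (toℕ x * toℕ y)) ⟨
    ((toℕ x * toℕ y) mod2^ n) % 2 ≡⟨ cong (_% 2) xy≡1 ⟩
    (1 mod2^ n) % 2               ≡⟨ mod2-eq (mod2^-parity n n≥1 1) ⟩
    1                             ∎)
    where open ≡-Reasoning

sumFin-even : ∀ ν (f : Fin ν → ℕ) → (∀ i → f i ≡₂ 0) → sumFin ν f ≡₂ 0
sumFin-even zero    f even = mod2 refl
sumFin-even (suc ν) f even = +-cong₂ (even zero) (sumFin-even ν (λ i → f (suc i)) (λ i → even (suc i)))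

Δ₂ : ℕ → ℕ → ℕ → ℕ
Δ₂ z x y = z * x * x + x * y + z * y * y

Δ₂-cong : ∀ {z z′ x x′ y y′} → z ≡₂ z′ → x ≡₂ x′ → y ≡₂ y′ → Δ₂ z x y ≡₂ Δ₂ z′ x′ y′
Δ₂-cong p q r = +-cong₂ (+-cong₂ (*-cong₂ (*-cong₂ p q) q) (*-cong₂ q r)) (*-cong₂ (*-cong₂ p r) r)

Δ₂-anisotropic : ∀ z x y → z ≡₂ 1 → x ≡₂ 1 ⊎ y ≡₂ 1 → Δ₂ z x y ≡₂ 1
Δ₂-anisotropic z x y z-odd x-or-y-odd with parity x | parity y
... | inj₁ x0 | inj₂ y1 = Δ₂-cong z-odd x0 y1
... | inj₂ x1 | inj₁ y0 = Δ₂-cong z-odd x1 y0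
... | inj₂ x1 | inj₂ y1 = ≡₂-trans (Δ₂-cong z-odd x1 y1) (mod2 refl)
... | inj₁ x0 | inj₁ y0 with x-or-y-odd
...   | inj₁ x1 = contradiction x1 (even-odd-absurd x0)
...   | inj₂ y1 = contradiction y1 (even-odd-absurd y0)

qΔ-odd : ∀ δ z (w : Fin (toℕ δ) → ℕ) → z ≡₂ 1 → (k : Fin (toℕ δ)) → w k ≡₂ 1 → qΔ δ z w ≡₂ 1
qΔ-odd (suc zero)       z w _     zero       w₀-odd = *-cong₂ w₀-odd w₀-odd
qΔ-odd (suc (suc zero)) z w z-odd zero       w₀-odd =
  Δ₂-anisotropic z (w zero) (w (suc zero)) z-odd (inj₁ w₀-odd)
qΔ-odd (suc (suc zero)) z w z-odd (suc zero) w₁-odd =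
  Δ₂-anisotropic z (w zero) (w (suc zero)) z-odd (inj₂ w₁-odd)

quadForm-odd : ∀ n ν δ (z : Zmod n) (a : Vect n ν δ) → toℕ z ≡₂ 1 →
  (∀ i → toℕ (a (i ↑ˡ toℕ δ)) ≡₂ 0) →
  (k : Fin (toℕ δ)) → toℕ (a ((ν + ν) ↑ʳ k)) ≡₂ 1 →
  quadForm n ν δ z a ≡₂ 1
quadForm-odd n ν δ z a z-odd hyperbolic-even k aₖ-odd =
  +-cong₂ (sumFin-even ν _ (λ i → *-cong₂ (hyperbolic-even (i ↑ˡ ν)) (hyperbolic-even (ν ↑ʳ i))))
          (qΔ-odd δ (toℕ z) (λ j → toℕ (a ((ν + ν) ↑ʳ j))) z-odd k aₖ-odd)

↑ˡ-or-↑ʳ : ∀ m {d} (j : Fin (m + d)) → (∃ λ i → i ↑ˡ d ≡ j) ⊎ (∃ λ k → m ↑ʳ k ≡ j)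
↑ˡ-or-↑ʳ m j with splitAt m j in eq
... | inj₁ i = inj₁ (i , splitAt⁻¹-↑ˡ eq)
... | inj₂ k = inj₂ (k , splitAt⁻¹-↑ʳ eq)

-- Lemma 2.1.  Either some hyperbolic coordinate of the vertex is odd, hence a
-- unit, or all are even: then the unit coordinate sits in the Δ-block and
-- a G aᵗ is odd, contradicting  a G aᵗ ≡ 0 (mod 2^n).
lemma2p1 : (n ν : ℕ) → n ≥ 1 → ν ≥ 1 → (δ : Fin 3) → (z : Zmod n) → IsUnit n z →
    (a : Vect n ν δ) → IsVertexRep n ν δ z a →
    ∃ λ (i : Fin (ν + ν)) → IsUnit n (a (i ↑ˡ toℕ δ))
lemma2p1 n ν n≥1 _ δ z z-unit a ((j , aⱼ-unit) , form≡0)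
  with any? (λ i → toℕ (a (i ↑ˡ toℕ δ)) % 2 ≟ 1)
... | yes (i , aᵢ-odd) = i , odd⇒unit n (a (i ↑ˡ toℕ δ)) (mod2 aᵢ-odd)
... | no no-odd-hyperbolic = ⊥-elim (even-odd-absurd form-even form-odd)
  where
  hyperbolic-even : ∀ i → toℕ (a (i ↑ˡ toℕ δ)) ≡₂ 0
  hyperbolic-even i with parity (toℕ (a (i ↑ˡ toℕ δ)))
  ... | inj₁ even       = even
  ... | inj₂ (mod2 odd) = contradiction (i , odd) no-odd-hyperbolic

  form-even : quadForm n ν δ z a ≡₂ 0
  form-even = mod2 (trans (sym (mod2-eq (mod2^-parity n n≥1 _))) (cong (_% 2) form≡0))

  form-odd : quadForm n ν δ z a ≡₂ 1
  form-odd with ↑ˡ-or-↑ʳ (ν + ν) j | unit⇒odd n n≥1 (a j) aⱼ-unit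
  ... | inj₁ (i , refl) | aⱼ-odd = contradiction (i , mod2-eq aⱼ-odd) no-odd-hyperbolic
  ... | inj₂ (k , refl) | aⱼ-odd =
    quadForm-odd n ν δ z a (unit⇒odd n n≥1 z z-unit) hyperbolic-even k aⱼ-odd
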